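{- Let $m$ be an odd prime and let $n\ge 2$ be an integer coprime to $m$. Set $\alpha=\frac{n^{m-1}-1}{m}$. Then $n$ is a primitive root modulo $m$ if and only if $\alpha$ is not periodic with respect to $n$ and length $m-1$, i.e. if and only if there is no divisor $d$ of $m-1$ with $d<m-1$ such that $\frac{n^{m-1}-1}{n^{d}-1}$ divides $\alpha$.
   Context: "Periodic" refers to the base $n$ representation of $\alpha$ written as a string of length $m-1$ (with leading zeros): it is periodic exactly when it is the concatenation of at least two copies of a shorter string, which is equivalent to divisibility of $\alpha$ by $\frac{n^{m-1}-1}{n^{d}-1}$ for some proper divisor $d$ of $m-1$. -}

module Defs where

open import Data.Nat using (ℕ; _+_; _*_; _∸_; _^_; _<_; _%_; NonZero)
open import Data.Nat.Divisibility using (_∣_)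
open import Data.Product using (Σ; _×_)
open import Relation.Nullary using (¬_)
open import Relation.Binary.PropositionalEquality using (_≡_)

PowIsOne : (m n k : ℕ) → Set
PowIsOne m n k = m ∣ (n ^ k ∸ 1)

HasOrder : (m n k : ℕ) → Set
HasOrder m n k =
  (0 < k) × PowIsOne m n k × (∀ j → 0 < j → j < k → ¬ PowIsOne m n j)

PrimitiveRoot : (m n : ℕ) → Set
PrimitiveRoot m n = HasOrder m n (m ∸ 1)

-- The quotient is given as an
-- explicit witness q with q * (n^d - 1) = n^L - 1 (exact division).
Periodic : (n L α : ℕ) → Set
Periodic n L α =
  Σ ℕ λ d → (d ∣ L) × (d < L) ×
    (Σ ℕ λ q → (q * (n ^ d ∸ 1) ≡ n ^ L ∸ 1) × (q ∣ α))

{-# OPTIONS --safe #-}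
-- Write N = n^L - 1 = m α with L = m - 1.  For d ∣ L the cofactor Q = N/(n^d - 1)
-- divides α = N/m exactly when m divides n^d - 1 (cross-multiply Q (n^d - 1) = m α).
-- So α is periodic iff n^d ≡ 1 (mod m) for a proper divisor d of L.  As n^L ≡ 1 and
-- the exponents e with n^e ≡ 1 are closed under gcd (Bézout), this holds iff some
-- 0 < j < L has n^j ≡ 1, i.e. iff n is not a primitive root.
module Submission where

open import Defs
open import Data.Nat using (ℕ; zero; suc; _+_; _*_; _∸_; _^_; _≤_; _<_; NonZero; >-nonZero; z<s)
open import Data.Nat.Base using (nonTrivial⇒n>1)
open import Data.Nat.Properties
open import Data.Nat.Divisibility
open import Data.Nat.GCD using (module GCD; module Bézout)
open import Data.Nat.Primality using (Prime; prime⇒nonZero; prime⇒nonTrivial)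
open import Data.Nat.Coprimality using (Coprime)
open import Data.Nat.Solver using (module +-*-Solver)
open import Data.Product using (Σ; _×_; _,_)
open import Relation.Nullary using (¬_)
open import Relation.Binary.PropositionalEquality using (_≡_; _≢_; refl; sym; trans; subst)
open import Function.Bundles using (_⇔_; mk⇔)

*∸1 : ∀ u v .{{_ : NonZero u}} .{{_ : NonZero v}} → u * v ∸ 1 ≡ v * (u ∸ 1) + (v ∸ 1)
*∸1 (suc x) (suc y) = solve 2 (λ x y → y :+ x :* (con 1 :+ y) := (con 1 :+ y) :* x :+ y) refl x y
  where open +-*-Solver

^∸1-+ : ∀ n .{{_ : NonZero n}} a b → n ^ (a + b) ∸ 1 ≡ n ^ b * (n ^ a ∸ 1) + (n ^ b ∸ 1)
^∸1-+ n a b rewrite ^-distribˡ-+-* n a b = *∸1 (n ^ a) (n ^ b) {{m^n≢0 n a}} {{m^n≢0 n b}}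

module _ {k n : ℕ} .{{_ : NonZero n}} where

  powIsOne-0 : PowIsOne k n 0
  powIsOne-0 = k ∣0

  powIsOne-+ : ∀ a b → PowIsOne k n a → PowIsOne k n b → PowIsOne k n (a + b)
  powIsOne-+ a b ka kb rewrite ^∸1-+ n a b = ∣m∣n⇒∣m+n (∣-trans ka (n∣m*n (n ^ b))) kb

  powIsOne-+⁻¹ : ∀ a b → PowIsOne k n (a + b) → PowIsOne k n a → PowIsOne k n b
  powIsOne-+⁻¹ a b kab ka rewrite ^∸1-+ n a b = ∣m+n∣m⇒∣n kab (∣-trans ka (n∣m*n (n ^ b)))

  powIsOne-* : ∀ c a → PowIsOne k n a → PowIsOne k n (c * a)
  powIsOne-* zero    a ka = powIsOne-0
  powIsOne-* (suc c) a ka = powIsOne-+ a (c * a) ka (powIsOne-* c a ka)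

  powIsOne-∣ : ∀ {d e} → d ∣ e → PowIsOne k n d → PowIsOne k n e
  powIsOne-∣ {d} (divides c refl) kd = powIsOne-* c d kd

  powIsOne-bézout : ∀ {d a b} → Bézout.Identity d a b →
                    PowIsOne k n a → PowIsOne k n b → PowIsOne k n d
  powIsOne-bézout {d} {a} {b} (Bézout.+- x y eq) ka kb =
    powIsOne-+⁻¹ (y * b) d
      (subst (PowIsOne k n) (trans (sym eq) (+-comm d (y * b))) (powIsOne-* x a ka))
      (powIsOne-* y b kb)
  powIsOne-bézout {d} {a} {b} (Bézout.-+ x y eq) ka kb =
    powIsOne-+⁻¹ (x * a) d
      (subst (PowIsOne k n) (trans (sym eq) (+-comm d (x * a))) (powIsOne-* y b kb))
      (powIsOne-* x a ka)

^∸1∣^∸1 : ∀ n .{{_ : NonZero n}} {d e} → d ∣ e → (n ^ d ∸ 1) ∣ (n ^ e ∸ 1)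
^∸1∣^∸1 n d∣e = powIsOne-∣ d∣e ∣-refl

q∣α⇒m∣e : ∀ {m α q e} .{{_ : NonZero q}} → m * α ≡ q * e → q ∣ α → m ∣ e
q∣α⇒m∣e {m} {α} {q} {e} eq q∣α =
  *-cancelˡ-∣ q (subst (_∣ q * e) (*-comm m q) (subst (m * q ∣_) eq (*-monoʳ-∣ m q∣α)))

m∣e⇒q∣α : ∀ {m α q e} .{{_ : NonZero m}} → m * α ≡ q * e → m ∣ e → q ∣ α
m∣e⇒q∣α {m} {α} {q} {e} eq m∣e =
  *-cancelʳ-∣ m (subst (q * m ∣_) (trans (sym eq) (*-comm m α)) (*-monoʳ-∣ q m∣e))

powIsOne-exponent : ∀ {m n L α} → m * α ≡ n ^ L ∸ 1 → PowIsOne m n L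
powIsOne-exponent {m} {α = α} mα≡N = divides α (trans (sym mα≡N) (*-comm m α))

PowIsOneBelow : (m n L : ℕ) → Set
PowIsOneBelow m n L = Σ ℕ λ j → (0 < j) × (j < L) × PowIsOne m n j

periodic⇒powIsOneBelow : ∀ {m n L α} → 0 < L → 0 < n ^ L ∸ 1 → m * α ≡ n ^ L ∸ 1 →
                         Periodic n L α → PowIsOneBelow m n L
periodic⇒powIsOneBelow {m} {n} {L} 0<L 0<N mα≡N (d , d∣L , d<L , q , qe≡N , q∣α) =
  d , 0<d , d<L , q∣α⇒m∣e {{q≢0}} (trans mα≡N (sym qe≡N)) q∣α
  where
  0<d : 0 < d
  0<d = n≢0⇒n>0 λ { refl → n>0⇒n≢0 0<L (0∣⇒≡0 d∣L) }
  q≢0 : NonZero q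
  q≢0 = m*n≢0⇒m≢0 q {{>-nonZero (subst (0 <_) (sym qe≡N) 0<N)}}

powIsOneBelow⇒periodic : ∀ {m n L α} .{{_ : NonZero m}} .{{_ : NonZero n}} →
                         m * α ≡ n ^ L ∸ 1 → PowIsOneBelow m n L → Periodic n L α
powIsOneBelow⇒periodic {m} {n} {L} {α} mα≡N (j , 0<j , j<L , powIsOne-j)
  with Bézout.lemma j L
... | Bézout.result d gcd bézout =
  d , GCD.gcd∣n gcd , d<L , quotient cofactor , sym (equality cofactor) ,
  m∣e⇒q∣α (trans mα≡N (equality cofactor)) powIsOne-d
  where
  open _∣_
  d<L : d < L
  d<L = ≤-<-trans (∣⇒≤ {{>-nonZero 0<j}} (GCD.gcd∣m gcd)) j<L
  powIsOne-d : PowIsOne m n d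
  powIsOne-d = powIsOne-bézout bézout powIsOne-j (powIsOne-exponent {n = n} {L} mα≡N)
  cofactor : (n ^ d ∸ 1) ∣ (n ^ L ∸ 1)
  cofactor = ^∸1∣^∸1 n (GCD.gcd∣n gcd)

hasOrder⇔¬periodic : ∀ {m n L α} .{{_ : NonZero m}} → 0 < L → 1 < n →
                     m * α ≡ n ^ L ∸ 1 → HasOrder m n L ⇔ (¬ Periodic n L α)
hasOrder⇔¬periodic {m} {n} {L} {α} 0<L 1<n mα≡N = mk⇔ to from
  where
  instance
    n≢0 : NonZero n
    n≢0 = >-nonZero (<-trans z<s 1<n)
  to : HasOrder m n L → ¬ Periodic n L α
  to (_ , _ , minimal) periodic
    with j , 0<j , j<L , powIsOne-j ← periodic⇒powIsOneBelow 0<L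
           (m<n⇒0<n∸m (^-monoʳ-< n 1<n 0<L)) mα≡N periodic
    = minimal j 0<j j<L powIsOne-j
  from : ¬ Periodic n L α → HasOrder m n L
  from aperiodic =
    0<L , powIsOne-exponent {n = n} {L} mα≡N ,
    λ j 0<j j<L powIsOne-j → aperiodic (powIsOneBelow⇒periodic mα≡N (j , 0<j , j<L , powIsOne-j))

proposition1 : (m n α : ℕ) → Prime m → m ≢ 2 → 2 ≤ n → Coprime n m
    → m * α ≡ n ^ (m ∸ 1) ∸ 1
    → PrimitiveRoot m n ⇔ (¬ Periodic n (m ∸ 1) α)
proposition1 m n α m-prime _ 1<n _ mα≡N =
  hasOrder⇔¬periodic {{prime⇒nonZero m-prime}}
    (m<n⇒0<n∸m (nonTrivial⇒n>1 m {{prime⇒nonTrivial m-prime}})) 1<n mα≡N
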